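{- Let $\mathcal{L}\subseteq\mathbb{Z}^3$ be an order ideal with $\mathcal{L}\subseteq C(0,0,0)$ and $\mathcal{U}\cap C(0,0,0)$ finite, let $\mathcal{I}$ be as in the context, and suppose $r_a(i_0,j_0,k_0)\subseteq\mathcal{I}$ is a rhombus. Then for any cutoff $N$ for $\mathcal{I}$ and any $\mathcal{I}$-grove $G$ within radius $N$, $$\sum_{\substack{(i,j,k)\in\mathcal{I}\\ j<j_0,\ k<k_0}}\bigl(\deg_G(i,j,k)-2\bigr)$$ (a sum with only finitely many nonzero terms) equals $-1$ if the long edge $e_a(i_0,j_0,k_0)$ lies in $G$, and $0$ if it does not.
   Context: For $(i,j,k)\in\mathbb{Z}^3$ let $C(i,j,k)=\{(i',j',k') : i'\le i,\ j'\le j,\ k'\le k\}$. $\mathcal{L}\subseteq\mathbb{Z}^3$ satisfies: $(i,j,k)\in\mathcal{L}\Rightarrow C(i,j,k)\subseteq\mathcal{L}$. $\mathcal{U}=\mathbb{Z}^3\setminus\mathcal{L}$, $\mathcal{I}=\{(i,j,k)\in\mathcal{L} : (i+1,j+1,k+1)\in\mathcal{U}\}$. A cutoff for $\mathcal{I}$ is an integer $N$ such that (i) $(i,j,k)\in\mathcal{I}$ whenever $i+j+k\le -N$ and $\max\{i,j,k\}=0$; (ii) $(i,j,k)\notin\mathcal{I}$ whenever $i+j+k\le -N-3$ and $\max\{i,j,k\}<0$. For $(i,j,k)\in\mathcal{I}$ let $r_a(i,j,k)=\{(i,j,k),(i,j-1,k),(i,j,k-1),(i,j-1,k-1)\}$,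 $r_b(i,j,k)=\{(i,j,k),(i-1,j,k),(i,j,k-1),(i-1,j,k-1)\}$, $r_c(i,j,k)=\{(i,j,k),(i-1,j,k),(i,j-1,k),(i-1,j-1,k)\}$; a rhombus is such a set contained in $\mathcal{I}$. Long edges: $e_a(i,j,k)=\{(i,j-1,k),(i,j,k-1)\}$, $e_b(i,j,k)=\{(i-1,j,k),(i,j,k-1)\}$, $e_c(i,j,k)=\{(i-1,j,k),(i,j-1,k)\}$; short edges: $e'_a(i,j,k)=\{(i,j,k),(i,j-1,k-1)\}$, $e'_b(i,j,k)=\{(i,j,k),(i-1,j,k-1)\}$, $e'_c(i,j,k)=\{(i,j,k),(i-1,j-1,k)\}$ (for $r_a,r_b,r_c$ respectively). $\mathcal{G}$ is the graph on $\mathcal{I}$ whose edges are the long and short edges of all rhombi. An $\mathcal{I}$-grove within radius $N$ is a subgraph $G\subseteq\mathcal{G}$ with: vertex set all of $\mathcal{I}$; for every rhombus exactly one of its two edges in $G$; for every rhombus all of whose vertices satisfy $i+j+k<-N$, its short edge in $G$; and every component of $G$ contains exactly one of the following sets, each of which lies in some component: $\{(0,p,q),(p,0,q)\}$, $\{(p,q,0),(0,q,p)\}$, $\{(q,0,p),(q,p,0)\}$ for $0>p>q$, $p+q\in\{ -N-1,-N-2\}$; $\{(0,p,p),(p,0,p),(p,p,0)\}$ for $2p\in\{ -N-1,-N-2\}$; $\{(0,0,q)\},\{(0,q,0)\},\{(q,0,0)\}$ for $q\le -N-1$. -}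

module Defs where

open import Data.Integer using (ℤ; +_; -_; _+_; _-_; _*_; _≤_; _<_; _<?_; 0ℤ; 1ℤ)
open import Data.Nat using (ℕ)
import Data.Nat.ListAction
open import Data.Bool using (Bool; true; false; not; _∧_; if_then_else_)
open import Data.Product using (_×_; _,_; Σ; ∃; ∃₂)
open import Data.Sum using (_⊎_)
open import Data.List using (List; []; _∷_; map; foldr; upTo; concatMap)
open import Data.List.Membership.Propositional using (_∈_)
open import Data.List.Relation.Unary.All using (All)
open import Relation.Nullary using (does)
open import Relation.Binary.PropositionalEquality using (_≡_)

P : Set
P = ℤ × ℤ × ℤ

_+P_ : P → P → P
(i , j , k) +P (i' , j' , k') = (i + i' , j + j' , k + k')

-- q ≤P p  means  q ∈ C(p)
_≤P_ : P → P → Set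
(i , j , k) ≤P (i' , j' , k') = (i ≤ i') × (j ≤ j') × (k ≤ k')

origin : P
origin = (0ℤ , 0ℤ , 0ℤ)

Subset : Set
Subset = P → Bool

IsOrderIdeal : Subset → Set
IsOrderIdeal L = ∀ p q → L p ≡ true → q ≤P p → L q ≡ true

-- 𝓘 = { p ∈ 𝓛 : p + (1,1,1) ∈ 𝓤 },  𝓤 = ℤ³ ∖ 𝓛
inI : Subset → P → Bool
inI L p = L p ∧ not (L (p +P (1ℤ , 1ℤ , 1ℤ)))

sumℤ : List ℤ → ℤ
sumℤ = foldr _+_ 0ℤ

max3 : ℤ → ℤ → ℤ → ℤ
max3 i j k = i Data.Integer.⊔ (j Data.Integer.⊔ k)

IsCutoff : Subset → ℤ → Set
IsCutoff L N =
  (∀ i j k → i + j + k ≤ - N → max3 i j k ≡ 0ℤ → inI L (i , j , k) ≡ true) ×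
  (∀ i j k → i + j + k ≤ - N - + 3 → max3 i j k < 0ℤ → inI L (i , j , k) ≡ false)

data RType : Set where
  ra rb rc : RType

longEdge : RType → P → P × P
longEdge ra (i , j , k) = ((i , j - 1ℤ , k) , (i , j , k - 1ℤ))
longEdge rb (i , j , k) = ((i - 1ℤ , j , k) , (i , j , k - 1ℤ))
longEdge rc (i , j , k) = ((i - 1ℤ , j , k) , (i , j - 1ℤ , k))

shortEdge : RType → P → P × P
shortEdge ra (i , j , k) = ((i , j , k) , (i , j - 1ℤ , k - 1ℤ))
shortEdge rb (i , j , k) = ((i , j , k) , (i - 1ℤ , j , k - 1ℤ))
shortEdge rc (i , j , k) = ((i , j , k) , (i - 1ℤ , j - 1ℤ , k))

fst : P × P → P
fst (x , _) = x

snd : P × P → P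
snd (_ , y) = y

rhombusVerts : RType → P → List P
rhombusVerts t p = fst (shortEdge t p) ∷ fst (longEdge t p) ∷ snd (longEdge t p) ∷ snd (shortEdge t p) ∷ []

IsRhombus : Subset → RType → P → Set
IsRhombus L t p = All (λ x → inI L x ≡ true) (rhombusVerts t p)

SameEdge : P → P → P × P → Set
SameEdge x y e = ((x , y) ≡ e) ⊎ ((y , x) ≡ e)

sumP : P → ℤ
sumP (i , j , k) = i + j + k

data Conn (E : P → P → Bool) : P → P → Set where
  here : ∀ {x} → Conn E x x
  step : ∀ {x y z} → E x y ≡ true → Conn E y z → Conn E x z

-- Codes indexing the distinguished sets of the grove boundary condition
data Code : Set where
  a1 a2 a3 : ℤ → ℤ → Code
  b0 : ℤ → Code
  c1 c2 c3 : ℤ → Code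

two : ℤ
two = + 2

ValidCode : ℤ → Code → Set
ValidCode N (a1 p q) = (q < p) × (p < 0ℤ) × ((p + q ≡ - N - 1ℤ) ⊎ (p + q ≡ - N - two))
ValidCode N (a2 p q) = (q < p) × (p < 0ℤ) × ((p + q ≡ - N - 1ℤ) ⊎ (p + q ≡ - N - two))
ValidCode N (a3 p q) = (q < p) × (p < 0ℤ) × ((p + q ≡ - N - 1ℤ) ⊎ (p + q ≡ - N - two))
ValidCode N (b0 p) = (two * p ≡ - N - 1ℤ) ⊎ (two * p ≡ - N - two)
ValidCode N (c1 q) = q ≤ - N - 1ℤ
ValidCode N (c2 q) = q ≤ - N - 1ℤ
ValidCode N (c3 q) = q ≤ - N - 1ℤ

codeSet : Code → List P
codeSet (a1 p q) = (0ℤ , p , q) ∷ (p , 0ℤ , q) ∷ []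
codeSet (a2 p q) = (p , q , 0ℤ) ∷ (0ℤ , q , p) ∷ []
codeSet (a3 p q) = (q , 0ℤ , p) ∷ (q , p , 0ℤ) ∷ []
codeSet (b0 p) = (0ℤ , p , p) ∷ (p , 0ℤ , p) ∷ (p , p , 0ℤ) ∷ []
codeSet (c1 q) = (0ℤ , 0ℤ , q) ∷ []
codeSet (c2 q) = (0ℤ , q , 0ℤ) ∷ []
codeSet (c3 q) = (q , 0ℤ , 0ℤ) ∷ []

CompContains : (P → P → Bool) → P → Code → Set
CompContains E v c = All (Conn E v) (codeSet c)

record IsGrove (L : Subset) (N : ℤ) (E : P → P → Bool) : Set where
  field
    symm : ∀ x y → E x y ≡ E y x
    sub : ∀ x y → E x y ≡ true →
          ∃₂ λ (t : RType) (p : P) → IsRhombus L t p ×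
            (SameEdge x y (longEdge t p) ⊎ SameEdge x y (shortEdge t p))
    exactlyOne : ∀ t p → IsRhombus L t p →
          E (fst (longEdge t p)) (snd (longEdge t p)) ≡ not (E (fst (shortEdge t p)) (snd (shortEdge t p)))
    farShort : ∀ t p → IsRhombus L t p → All (λ x → sumP x < - N) (rhombusVerts t p) →
          E (fst (shortEdge t p)) (snd (shortEdge t p)) ≡ true
    setsConnected : ∀ c → ValidCode N c →
          All (λ x → inI L x ≡ true) (codeSet c) × All (λ x → All (Conn E x) (codeSet c)) (codeSet c)
    compHasOne : ∀ v → inI L v ≡ true → Σ Code λ c → ValidCode N c × CompContains E v c
    compHasAtMostOne : ∀ v c c' → inI L v ≡ true → ValidCode N c → ValidCode N c' →
          CompContains E v c → CompContains E v c' → c ≡ c'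

-- The 12 possible neighbour offsets in 𝓖 (long and short edges, both directions)
neighbourOffsets : List P
neighbourOffsets =
  (0ℤ , 1ℤ , - 1ℤ) ∷ (0ℤ , - 1ℤ , 1ℤ) ∷
  (1ℤ , 0ℤ , - 1ℤ) ∷ (- 1ℤ , 0ℤ , 1ℤ) ∷
  (1ℤ , - 1ℤ , 0ℤ) ∷ (- 1ℤ , 1ℤ , 0ℤ) ∷
  (0ℤ , 1ℤ , 1ℤ) ∷ (0ℤ , - 1ℤ , - 1ℤ) ∷
  (1ℤ , 0ℤ , 1ℤ) ∷ (- 1ℤ , 0ℤ , - 1ℤ) ∷
  (1ℤ , 1ℤ , 0ℤ) ∷ (- 1ℤ , - 1ℤ , 0ℤ) ∷ []

-- deg_G(p): number of G-neighbours of p (all lie among the 12 offsets since G ⊆ 𝓖)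
deg : (P → P → Bool) → P → ℕ
deg E p = Data.Nat.ListAction.sum (map (λ o → if E p (p +P o) then 1 else 0) neighbourOffsets)

range : ℕ → List ℤ
range M = map (λ n → - (+ n)) (upTo (Data.Nat.suc M))

boxSum : Subset → (P → P → Bool) → ℤ → ℤ → ℕ → ℤ
boxSum L E j0 k0 M =
  sumℤ (concatMap (λ i → concatMap (λ j → map (λ k →
     if inI L (i , j , k) ∧ does (j <? j0) ∧ does (k <? k0)
     then + deg E (i , j , k) - two else 0ℤ) (range M)) (range M)) (range M))

{-# OPTIONS --safe #-}
module Submission where

-- Every edge of 𝓖 at a vertex v is an edge of exactly one rhombus, and the twelve possible
-- neighbours of v correspond to twelve (rhombus, edge, orientation) steps. Attaching to each
-- rhombus a flow, 1 or 0 according to whether G contains its long edge (shifted by −1 for type c),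
-- deg_G v becomes a constant plus a discrete divergence of the flow. The order-ideal structure of
-- 𝓛 makes the constant equal to 2 at every v ∈ 𝓘, and the divergence vanishes off 𝓘. Far from the
-- origin the flow vanishes: r_a and r_b rhombi use their short edges there, and the cutoff rules
-- out r_c rhombi. Hence the sum of deg_G − 2 over the box j < j₀, k < k₀ telescopes to minus the
-- flow through the rhombi r_a(i, j₀, k₀); only i = i₀ carries one, and its flow is 1 exactly when
-- e_a(i₀, j₀, k₀) ∈ G.

open import Defs
open import Data.Integer using (ℤ; +_; -_; _<_; 0ℤ; 1ℤ)
open import Data.Nat using (ℕ)
open import Data.Bool using (Bool; true; false)
open import Data.Product using (_×_; _,_; ∃)
open import Data.Sum using (_⊎_)
open import Data.List using (List)
open import Data.List.Membership.Propositional using (_∈_)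
open import Relation.Binary.PropositionalEquality using (_≡_)

open import Algebra using (AbelianGroup)
open import Data.Bool using (not; _∧_; if_then_else_)
open import Data.Bool.ListAction using (all)
open import Data.Bool.Properties
  using (if-float; ∧-zeroʳ; ∧-identityʳ; ∧-conicalˡ; ∧-conicalʳ; not-involutive; ¬-not; T-≡)
open import Data.Empty using (⊥)
open import Data.Integer using (-[1+_]; +[1+_]; _+_; _-_; _≤_; _<?_; _⊓_; ∣_∣; +≤+; -<+; +<+)
import Data.Integer.Properties as ℤ
open import Data.Integer.Tactic.RingSolver using (solve-∀)
open import Data.List using ([]; _∷_; map; upTo; concatMap; _++_)
import Data.List.Properties as List
open import Data.List.Relation.Unary.All using (All; []; _∷_)
import Data.List.Relation.Unary.All as All
open import Data.List.Relation.Unary.All.Properties using (all⁺; all⁻)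
open import Data.List.Relation.Unary.Any using (here; there)
import Data.Nat as ℕ
open import Data.Nat.ListAction using () renaming (sum to ℕsum)
import Data.Nat.Properties as ℕ
open import Data.Product using (proj₁; proj₂; swap)
open import Data.Sum using (inj₁; inj₂)
import Data.Sum as ⊎
open import Function using (_∘_; Equivalence)
open import Relation.Binary.Definitions using (tri<; tri≈; tri>)
open import Relation.Binary.PropositionalEquality
  using (refl; sym; trans; cong; cong₂; subst; _≢_; module ≡-Reasoning)
open import Relation.Nullary using (does; yes; no; ¬_; contradiction)

open import Algebra.Properties.Group (AbelianGroup.group ℤ.+-0-abelianGroup) using (∙-cancelˡ)
open ≡-Reasoning

-- Sums and telescoping

sumℤ-++ : ∀ xs ys → sumℤ (xs ++ ys) ≡ sumℤ xs + sumℤ ys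
sumℤ-++ [] ys = sym (ℤ.+-identityˡ _)
sumℤ-++ (x ∷ xs) ys = trans (cong (_+_ x) (sumℤ-++ xs ys)) (sym (ℤ.+-assoc x _ _))

∑ : {A : Set} → List A → (A → ℤ) → ℤ
∑ xs f = sumℤ (map f xs)

module _ {A : Set} where

  ∑-concatMap : ∀ (g : A → List ℤ) xs → sumℤ (concatMap g xs) ≡ ∑ xs (λ x → sumℤ (g x))
  ∑-concatMap g [] = refl
  ∑-concatMap g (x ∷ xs) =
    trans (sumℤ-++ (g x) (concatMap g xs)) (cong (_+_ (sumℤ (g x))) (∑-concatMap g xs))

  ∑-map : ∀ {B : Set} (f : B → A) xs (g : A → ℤ) → ∑ (map f xs) g ≡ ∑ xs (g ∘ f)
  ∑-map f xs g = cong sumℤ (sym (List.map-∘ xs))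

  ∑-cong : ∀ xs {f g : A → ℤ} → (∀ x → f x ≡ g x) → ∑ xs f ≡ ∑ xs g
  ∑-cong [] h = refl
  ∑-cong (x ∷ xs) h = cong₂ _+_ (h x) (∑-cong xs h)

  ∑-zero : ∀ xs {f : A → ℤ} → (∀ x → f x ≡ 0ℤ) → ∑ xs f ≡ 0ℤ
  ∑-zero [] h = refl
  ∑-zero (x ∷ xs) h = cong₂ _+_ (h x) (∑-zero xs h)

  ∑-+ : ∀ xs (f g : A → ℤ) → ∑ xs (λ x → f x + g x) ≡ ∑ xs f + ∑ xs g
  ∑-+ [] f g = refl
  ∑-+ (x ∷ xs) f g = trans (cong (_+_ (f x + g x)) (∑-+ xs f g)) (interchange (f x) (g x) _ _)
    where
    interchange : ∀ a b c d → (a + b) + (c + d) ≡ (a + c) + (b + d)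
    interchange = solve-∀

  ∑-neg : ∀ xs (f : A → ℤ) → ∑ xs (λ x → - f x) ≡ - ∑ xs f
  ∑-neg [] f = refl
  ∑-neg (x ∷ xs) f = trans (cong (_+_ (- f x)) (∑-neg xs f)) (sym (ℤ.neg-distrib-+ (f x) _))

  ∑-sub : ∀ xs (f g : A → ℤ) → ∑ xs (λ x → f x - g x) ≡ ∑ xs f - ∑ xs g
  ∑-sub xs f g = trans (∑-+ xs f (λ x → - g x)) (cong (_+_ (∑ xs f)) (∑-neg xs g))

when : Bool → ℤ → ℤ
when b z = if b then z else 0ℤ

when-sub : ∀ b x y → when b (x - y) ≡ when b x - when b y
when-sub true  x y = refl
when-sub false x y = refl

when-+ : ∀ b x y → when b (x + y) ≡ when b x + when b y
when-+ true  x y = refl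
when-+ false x y = refl

when-0 : ∀ b → when b 0ℤ ≡ 0ℤ
when-0 true  = refl
when-0 false = refl

when-neg : ∀ b x → when b (- x) ≡ - when b x
when-neg true  x = refl
when-neg false x = refl

∑-when : ∀ {A : Set} xs b (f : A → ℤ) → ∑ xs (λ x → when b (f x)) ≡ when b (∑ xs f)
∑-when xs true f = refl
∑-when xs false f = ∑-zero xs (λ _ → refl)

range-suc : ∀ M → range (ℕ.suc M) ≡ range M ++ (-[1+ M ] ∷ [])
range-suc M = trans (cong (map λ n → - (+ n)) (sym (List.upTo-∷ʳ (ℕ.suc M))))
                    (List.map-++ (λ n → - (+ n)) (upTo (ℕ.suc M)) (ℕ.suc M ∷ []))

∑-range-suc : ∀ M f → ∑ (range (ℕ.suc M)) f ≡ ∑ (range M) f + f -[1+ M ]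
∑-range-suc M f = begin
  sumℤ (map f (range (ℕ.suc M)))               ≡⟨ cong (λ xs → sumℤ (map f xs)) (range-suc M) ⟩
  sumℤ (map f (range M ++ (-[1+ M ] ∷ [])))    ≡⟨ cong sumℤ (List.map-++ f (range M) _) ⟩
  sumℤ (map f (range M) ++ (f -[1+ M ] ∷ []))  ≡⟨ sumℤ-++ (map f (range M)) _ ⟩
  ∑ (range M) f + (f -[1+ M ] + 0ℤ)            ≡⟨ cong (_+_ (∑ (range M) f)) (ℤ.+-identityʳ _) ⟩
  ∑ (range M) f + f -[1+ M ]                   ∎

telescope : ∀ M (h : ℤ → ℤ) → ∑ (range M) (λ z → h (z + 1ℤ) - h z) ≡ h 1ℤ - h (- + M)
telescope ℕ.zero h = ℤ.+-identityʳ _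
telescope (ℕ.suc M) h = begin
  ∑ (range (ℕ.suc M)) Δh
    ≡⟨ ∑-range-suc M Δh ⟩
  ∑ (range M) Δh + Δh -[1+ M ]
    ≡⟨ cong₂ _+_ (telescope M h) (cong (λ z → h z - h -[1+ M ]) (pred+1 M)) ⟩
  (h 1ℤ - h (- + M)) + (h (- + M) - h -[1+ M ])
    ≡⟨ collapse (h 1ℤ) (h (- + M)) (h -[1+ M ]) ⟩
  h 1ℤ - h -[1+ M ]  ∎
  where
  Δh : ℤ → ℤ
  Δh z = h (z + 1ℤ) - h z
  pred+1 : ∀ M → -[1+ M ] + 1ℤ ≡ - + M
  pred+1 ℕ.zero = refl
  pred+1 (ℕ.suc M) = refl
  collapse : ∀ a b c → (a - b) + (b - c) ≡ a - c
  collapse = solve-∀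

z≤z+1 : ∀ z → z ≤ z + 1ℤ
z≤z+1 z = ℤ.i≤i+j z 1ℤ

<⇒+1≤ : ∀ {a b} → a < b → a + 1ℤ ≤ b
<⇒+1≤ {a} a<b = ℤ.≤-trans (ℤ.≤-reflexive (ℤ.+-comm a 1ℤ)) (ℤ.i<j⇒suc[i]≤j a<b)

telescope-below : ∀ M {b} → - + M ≤ b → b ≤ 1ℤ → ∀ (h : ℤ → ℤ) →
  ∑ (range M) (λ z → when (does (z <? b)) (h (z + 1ℤ) - h z)) ≡ h b - h (- + M)
telescope-below M {b} -M≤b b≤1 h = begin
  ∑ (range M) (λ z → when (does (z <? b)) (h (z + 1ℤ) - h z))
    ≡⟨ ∑-cong (range M) clamp ⟩
  ∑ (range M) (λ z → g (z + 1ℤ) - g z)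
    ≡⟨ telescope M g ⟩
  g 1ℤ - g (- + M)
    ≡⟨ cong₂ (λ x y → h x - h y) (ℤ.i≥j⇒i⊓j≡j b≤1) (ℤ.i≤j⇒i⊓j≡i -M≤b) ⟩
  h b - h (- + M)  ∎
  where
  g : ℤ → ℤ
  g z = h (z ⊓ b)
  clamp : ∀ z → when (does (z <? b)) (h (z + 1ℤ) - h z) ≡ g (z + 1ℤ) - g z
  clamp z with z <? b
  ... | yes z<b =
    cong₂ (λ x y → h x - h y) (sym (ℤ.i≤j⇒i⊓j≡i (<⇒+1≤ z<b))) (sym (ℤ.i≤j⇒i⊓j≡i (ℤ.<⇒≤ z<b)))
  ... | no z≮b = sym (begin
    h ((z + 1ℤ) ⊓ b) - h (z ⊓ b)
      ≡⟨ cong₂ (λ x y → h x - h y) (ℤ.i≥j⇒i⊓j≡j (ℤ.≤-trans b≤z (z≤z+1 z))) (ℤ.i≥j⇒i⊓j≡j b≤z) ⟩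
    h b - h b
      ≡⟨ ℤ.+-inverseʳ (h b) ⟩
    0ℤ  ∎)
    where b≤z = ℤ.≮⇒≥ z≮b

-n≢-[1+M] : ∀ {n M} → n ℕ.≤ M → - + n ≢ -[1+ M ]
-n≢-[1+M] n≤M eq = ℕ.<⇒≢ (ℕ.s≤s n≤M) (ℤ.+-injective (ℤ.neg-injective eq))

∑-range-zero : ∀ M {f : ℤ → ℤ} → (∀ n → n ℕ.≤ M → f (- + n) ≡ 0ℤ) → ∑ (range M) f ≡ 0ℤ
∑-range-zero ℕ.zero h = cong (_+ 0ℤ) (h 0 ℕ.z≤n)
∑-range-zero (ℕ.suc M) {f} h = trans (∑-range-suc M f)
  (cong₂ _+_ (∑-range-zero M {f} (λ n n≤M → h n (ℕ.m≤n⇒m≤1+n n≤M))) (h (ℕ.suc M) ℕ.≤-refl))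

∑-range-single-neg : ∀ {M m} → m ℕ.≤ M → ∀ (f : ℤ → ℤ) → (∀ z → z ≢ - + m → f z ≡ 0ℤ) →
  ∑ (range M) f ≡ f (- + m)
∑-range-single-neg {ℕ.zero} ℕ.z≤n f h = ℤ.+-identityʳ _
∑-range-single-neg {ℕ.suc M} m≤1+M f h with ℕ.m≤n⇒m<n∨m≡n m≤1+M
... | inj₁ (ℕ.s≤s m≤M) = trans (∑-range-suc M f)
  (trans (cong₂ _+_ (∑-range-single-neg m≤M f h) (h -[1+ M ] (-n≢-[1+M] m≤M ∘ sym))) (ℤ.+-identityʳ _))
... | inj₂ refl = trans (∑-range-suc M f)
  (trans (cong (_+ f -[1+ M ]) (∑-range-zero M {f} (λ n n≤M → h _ (-n≢-[1+M] n≤M)))) (ℤ.+-identityˡ _))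

∑-range-single : ∀ {M a} → - + M ≤ a → a ≤ 0ℤ → ∀ (f : ℤ → ℤ) → (∀ z → z ≢ a → f z ≡ 0ℤ) →
  ∑ (range M) f ≡ f a
∑-range-single {M} {+ 0}      _    _ = ∑-range-single-neg {M} ℕ.z≤n
∑-range-single {M} { -[1+ n ]} -M≤a _ = ∑-range-single-neg (ℤ.drop‿+≤+ (ℤ.neg-cancel-≤ -M≤a))
∑-range-single {M} {+[1+ n ]} _ (+≤+ ())

point-≡ : ∀ {a a′ b b′ c c′ : ℤ} → a ≡ a′ → b ≡ b′ → c ≡ c′ → (a , b , c) ≡ (a′ , b′ , c′)
point-≡ refl refl refl = refl

z+1-1≡z : ∀ z → z + 1ℤ - 1ℤ ≡ z
z+1-1≡z = solve-∀

z-1+1≡z : ∀ z → z - 1ℤ + 1ℤ ≡ z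
z-1+1≡z = solve-∀

z≡z+0 : ∀ z → z ≡ z + 0ℤ
z≡z+0 z = sym (ℤ.+-identityʳ z)

z-1≤z : ∀ z → z - 1ℤ ≤ z
z-1≤z z = ℤ.i-j≤i z 1ℤ

𝟏 : P
𝟏 = (1ℤ , 1ℤ , 1ℤ)

≤P-refl : ∀ {p} → p ≤P p
≤P-refl = ℤ.≤-refl , ℤ.≤-refl , ℤ.≤-refl

≤P-trans : ∀ {p q r} → p ≤P q → q ≤P r → p ≤P r
≤P-trans (a , b , c) (a′ , b′ , c′) = ℤ.≤-trans a a′ , ℤ.≤-trans b b′ , ℤ.≤-trans c c′

+𝟏-mono : ∀ {p q} → p ≤P q → (p +P 𝟏) ≤P (q +P 𝟏)
+𝟏-mono (a , b , c) = ℤ.+-monoˡ-≤ 1ℤ a , ℤ.+-monoˡ-≤ 1ℤ b , ℤ.+-monoˡ-≤ 1ℤ c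

+P-cancelˡ : ∀ v a b → v +P a ≡ v +P b → a ≡ b
+P-cancelˡ (i , j , k) a b eq = point-≡ (∙-cancelˡ i _ _ (cong proj₁ eq))
                                        (∙-cancelˡ j _ _ (cong (proj₁ ∘ proj₂) eq))
                                        (∙-cancelˡ k _ _ (cong (proj₂ ∘ proj₂) eq))

-- The edges of 𝓖 at a vertex

data EdgeKind : Set where
  long short : EdgeKind

data Orientation : Set where
  forward backward : Orientation

Step : Set
Step = RType × EdgeKind × Orientation

edge : EdgeKind → RType → P → P × P
edge long  = longEdge
edge short = shortEdge

orient : Orientation → P × P → P × P
orient forward  e = e
orient backward e = swap e

SameEdge⇒orient : ∀ {v w e} → SameEdge v w e → ∃ λ o → orient o e ≡ (v , w)
SameEdge⇒orient (inj₁ eq) = forward , sym eq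
SameEdge⇒orient (inj₂ eq) = backward , cong swap (sym eq)

offset : Step → P
offset (ra , long  , forward)  = (0ℤ , 1ℤ , - 1ℤ)
offset (ra , long  , backward) = (0ℤ , - 1ℤ , 1ℤ)
offset (rb , long  , forward)  = (1ℤ , 0ℤ , - 1ℤ)
offset (rb , long  , backward) = (- 1ℤ , 0ℤ , 1ℤ)
offset (rc , long  , forward)  = (1ℤ , - 1ℤ , 0ℤ)
offset (rc , long  , backward) = (- 1ℤ , 1ℤ , 0ℤ)
offset (ra , short , forward)  = (0ℤ , - 1ℤ , - 1ℤ)
offset (ra , short , backward) = (0ℤ , 1ℤ , 1ℤ)
offset (rb , short , forward)  = (- 1ℤ , 0ℤ , - 1ℤ)
offset (rb , short , backward) = (1ℤ , 0ℤ , 1ℤ)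
offset (rc , short , forward)  = (- 1ℤ , - 1ℤ , 0ℤ)
offset (rc , short , backward) = (1ℤ , 1ℤ , 0ℤ)

owner : Step → P → P
owner (ra , long  , forward)  (i , j , k) = (i , j + 1ℤ , k)
owner (ra , long  , backward) (i , j , k) = (i , j , k + 1ℤ)
owner (rb , long  , forward)  (i , j , k) = (i + 1ℤ , j , k)
owner (rb , long  , backward) (i , j , k) = (i , j , k + 1ℤ)
owner (rc , long  , forward)  (i , j , k) = (i + 1ℤ , j , k)
owner (rc , long  , backward) (i , j , k) = (i , j + 1ℤ , k)
owner (ra , short , forward)  (i , j , k) = (i , j , k)
owner (ra , short , backward) (i , j , k) = (i , j + 1ℤ , k + 1ℤ)
owner (rb , short , forward)  (i , j , k) = (i , j , k)
owner (rb , short , backward) (i , j , k) = (i + 1ℤ , j , k + 1ℤ)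
owner (rc , short , forward)  (i , j , k) = (i , j , k)
owner (rc , short , backward) (i , j , k) = (i + 1ℤ , j + 1ℤ , k)

owner-edge : ∀ t k o v → orient o (edge k t (owner (t , k , o) v)) ≡ (v , v +P offset (t , k , o))
owner-edge ra long forward (i , j , k) =
  cong₂ _,_ (point-≡ refl (z+1-1≡z j) refl) (point-≡ (z≡z+0 i) refl refl)
owner-edge ra long backward (i , j , k) =
  cong₂ _,_ (point-≡ refl refl (z+1-1≡z k)) (point-≡ (z≡z+0 i) refl refl)
owner-edge rb long forward (i , j , k) =
  cong₂ _,_ (point-≡ (z+1-1≡z i) refl refl) (point-≡ refl (z≡z+0 j) refl)
owner-edge rb long backward (i , j , k) =
  cong₂ _,_ (point-≡ refl refl (z+1-1≡z k)) (point-≡ refl (z≡z+0 j) refl)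
owner-edge rc long forward (i , j , k) =
  cong₂ _,_ (point-≡ (z+1-1≡z i) refl refl) (point-≡ refl refl (z≡z+0 k))
owner-edge rc long backward (i , j , k) =
  cong₂ _,_ (point-≡ refl (z+1-1≡z j) refl) (point-≡ refl refl (z≡z+0 k))
owner-edge ra short forward (i , j , k) =
  cong₂ _,_ refl (point-≡ (z≡z+0 i) refl refl)
owner-edge ra short backward (i , j , k) =
  cong₂ _,_ (point-≡ refl (z+1-1≡z j) (z+1-1≡z k)) (point-≡ (z≡z+0 i) refl refl)
owner-edge rb short forward (i , j , k) =
  cong₂ _,_ refl (point-≡ refl (z≡z+0 j) refl)
owner-edge rb short backward (i , j , k) =
  cong₂ _,_ (point-≡ (z+1-1≡z i) refl (z+1-1≡z k)) (point-≡ refl (z≡z+0 j) refl)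
owner-edge rc short forward (i , j , k) =
  cong₂ _,_ refl (point-≡ refl refl (z≡z+0 k))
owner-edge rc short backward (i , j , k) =
  cong₂ _,_ (point-≡ (z+1-1≡z i) (z+1-1≡z j) refl) (point-≡ refl refl (z≡z+0 k))

owner-source : ∀ t k o p → owner (t , k , o) (proj₁ (orient o (edge k t p))) ≡ p
owner-source ra long  forward  (i , j , k) = point-≡ refl (z-1+1≡z j) refl
owner-source ra long  backward (i , j , k) = point-≡ refl refl (z-1+1≡z k)
owner-source rb long  forward  (i , j , k) = point-≡ (z-1+1≡z i) refl refl
owner-source rb long  backward (i , j , k) = point-≡ refl refl (z-1+1≡z k)
owner-source rc long  forward  (i , j , k) = point-≡ (z-1+1≡z i) refl refl
owner-source rc long  backward (i , j , k) = point-≡ refl (z-1+1≡z j) refl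
owner-source ra short forward  (i , j , k) = refl
owner-source ra short backward (i , j , k) = point-≡ refl (z-1+1≡z j) (z-1+1≡z k)
owner-source rb short forward  (i , j , k) = refl
owner-source rb short backward (i , j , k) = point-≡ (z-1+1≡z i) refl (z-1+1≡z k)
owner-source rc short forward  (i , j , k) = refl
owner-source rc short backward (i , j , k) = point-≡ (z-1+1≡z i) (z-1+1≡z j) refl

owner-unique : ∀ t k o p {v w} → orient o (edge k t p) ≡ (v , w) →
  p ≡ owner (t , k , o) v × w ≡ v +P offset (t , k , o)
owner-unique t k o p {v} {w} eq = p≡owner , (begin
  w                                                      ≡⟨ cong proj₂ eq ⟨
  proj₂ (orient o (edge k t p))                          ≡⟨ cong (proj₂ ∘ orient o ∘ edge k t) p≡owner ⟩
  proj₂ (orient o (edge k t (owner (t , k , o) v)))      ≡⟨ cong proj₂ (owner-edge t k o v) ⟩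
  v +P offset (t , k , o)                                ∎)
  where
  p≡owner : p ≡ owner (t , k , o) v
  p≡owner = trans (sym (owner-source t k o p)) (cong (owner (t , k , o) ∘ proj₁) eq)

edge-owner : ∀ {t p v w} → SameEdge v w (longEdge t p) ⊎ SameEdge v w (shortEdge t p) →
  ∃ λ k → ∃ λ o → p ≡ owner (t , k , o) v × w ≡ v +P offset (t , k , o)
edge-owner {t} {p} (inj₁ same) =
  let o , eq = SameEdge⇒orient same in long , o , owner-unique t long o p eq
edge-owner {t} {p} (inj₂ same) =
  let o , eq = SameEdge⇒orient same in short , o , owner-unique t short o p eq

steps : List Step
steps = (ra , long , forward) ∷ (ra , long , backward) ∷
        (rb , long , forward) ∷ (rb , long , backward) ∷
        (rc , long , forward) ∷ (rc , long , backward) ∷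
        (ra , short , backward) ∷ (ra , short , forward) ∷
        (rb , short , backward) ∷ (rb , short , forward) ∷
        (rc , short , backward) ∷ (rc , short , forward) ∷ []

map-offset-steps : map offset steps ≡ neighbourOffsets
map-offset-steps = refl

stepOf : P → Step
stepOf (+ 0 , + 1 , -[1+ 0 ]) = (ra , long , forward)
stepOf (+ 0 , -[1+ 0 ] , + 1) = (ra , long , backward)
stepOf (+ 1 , + 0 , -[1+ 0 ]) = (rb , long , forward)
stepOf (-[1+ 0 ] , + 0 , + 1) = (rb , long , backward)
stepOf (+ 1 , -[1+ 0 ] , + 0) = (rc , long , forward)
stepOf (-[1+ 0 ] , + 1 , + 0) = (rc , long , backward)
stepOf (+ 0 , -[1+ 0 ] , -[1+ 0 ]) = (ra , short , forward)
stepOf (+ 0 , + 1 , + 1) = (ra , short , backward)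
stepOf (-[1+ 0 ] , + 0 , -[1+ 0 ]) = (rb , short , forward)
stepOf (+ 1 , + 0 , + 1) = (rb , short , backward)
stepOf (-[1+ 0 ] , -[1+ 0 ] , + 0) = (rc , short , forward)
stepOf (+ 1 , + 1 , + 0) = (rc , short , backward)
stepOf _ = (ra , long , forward)

stepOf-offset : ∀ s → stepOf (offset s) ≡ s
stepOf-offset (ra , long  , forward)  = refl
stepOf-offset (ra , long  , backward) = refl
stepOf-offset (rb , long  , forward)  = refl
stepOf-offset (rb , long  , backward) = refl
stepOf-offset (rc , long  , forward)  = refl
stepOf-offset (rc , long  , backward) = refl
stepOf-offset (ra , short , forward)  = refl
stepOf-offset (ra , short , backward) = refl
stepOf-offset (rb , short , forward)  = refl
stepOf-offset (rb , short , backward) = refl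
stepOf-offset (rc , short , forward)  = refl
stepOf-offset (rc , short , backward) = refl

offset-injective : ∀ s s′ → offset s ≡ offset s′ → s ≡ s′
offset-injective s s′ eq = trans (sym (stepOf-offset s)) (trans (cong stepOf eq) (stepOf-offset s′))

source-vertex : ∀ t k o p → proj₁ (orient o (edge k t p)) ∈ rhombusVerts t p
source-vertex t long  forward  p = there (here refl)
source-vertex t long  backward p = there (there (here refl))
source-vertex t short forward  p = here refl
source-vertex t short backward p = there (there (there (here refl)))

owner-≤ : ∀ s v → owner s v ≤P (v +P 𝟏)
owner-≤ (ra , long  , forward)  (i , j , k) = z≤z+1 i , ℤ.≤-refl , z≤z+1 k
owner-≤ (ra , long  , backward) (i , j , k) = z≤z+1 i , z≤z+1 j , ℤ.≤-refl
owner-≤ (rb , long  , forward)  (i , j , k) = ℤ.≤-refl , z≤z+1 j , z≤z+1 k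
owner-≤ (rb , long  , backward) (i , j , k) = z≤z+1 i , z≤z+1 j , ℤ.≤-refl
owner-≤ (rc , long  , forward)  (i , j , k) = ℤ.≤-refl , z≤z+1 j , z≤z+1 k
owner-≤ (rc , long  , backward) (i , j , k) = z≤z+1 i , ℤ.≤-refl , z≤z+1 k
owner-≤ (ra , short , forward)  (i , j , k) = z≤z+1 i , z≤z+1 j , z≤z+1 k
owner-≤ (ra , short , backward) (i , j , k) = z≤z+1 i , ℤ.≤-refl , ℤ.≤-refl
owner-≤ (rb , short , forward)  (i , j , k) = z≤z+1 i , z≤z+1 j , z≤z+1 k
owner-≤ (rb , short , backward) (i , j , k) = ℤ.≤-refl , z≤z+1 j , ℤ.≤-refl
owner-≤ (rc , short , forward)  (i , j , k) = z≤z+1 i , z≤z+1 j , z≤z+1 k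
owner-≤ (rc , short , backward) (i , j , k) = ℤ.≤-refl , ℤ.≤-refl , z≤z+1 k

owner-c-level : ∀ k o v → proj₂ (proj₂ (owner (rc , k , o) v)) ≡ proj₂ (proj₂ v)
owner-c-level long  forward  (i , j , k) = refl
owner-c-level long  backward (i , j , k) = refl
owner-c-level short forward  (i , j , k) = refl
owner-c-level short backward (i , j , k) = refl

vertices-≤ : ∀ t p → All (_≤P p) (rhombusVerts t p)
vertices-≤ ra (i , j , k) =
  ≤P-refl ∷ (ℤ.≤-refl , z-1≤z j , ℤ.≤-refl) ∷
  (ℤ.≤-refl , ℤ.≤-refl , z-1≤z k) ∷ (ℤ.≤-refl , z-1≤z j , z-1≤z k) ∷ []
vertices-≤ rb (i , j , k) =
  ≤P-refl ∷ (z-1≤z i , ℤ.≤-refl , ℤ.≤-refl) ∷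
  (ℤ.≤-refl , ℤ.≤-refl , z-1≤z k) ∷ (z-1≤z i , ℤ.≤-refl , z-1≤z k) ∷ []
vertices-≤ rc (i , j , k) =
  ≤P-refl ∷ (z-1≤z i , ℤ.≤-refl , ℤ.≤-refl) ∷
  (ℤ.≤-refl , z-1≤z j , ℤ.≤-refl) ∷ (z-1≤z i , z-1≤z j , ℤ.≤-refl) ∷ []

-- Counting edges by rhombus

bit : Bool → ℤ
bit b = if b then 1ℤ else 0ℤ

count-bits : ∀ {A : Set} (b : A → Bool) xs →
  + ℕsum (map (λ x → if b x then 1 else 0) xs) ≡ ∑ xs (λ x → bit (b x))
count-bits b [] = refl
count-bits b (x ∷ xs) =
  trans (ℤ.pos-+ (if b x then 1 else 0) _) (cong₂ _+_ (if-float +_ (b x)) (count-bits b xs))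

bit-long : ∀ r ℓ w → bit (r ∧ ℓ) ≡ bit (w ∧ r) + when r (bit ℓ - bit w)
bit-long false _     false = refl
bit-long false _     true  = refl
bit-long true  false false = refl
bit-long true  false true  = refl
bit-long true  true  false = refl
bit-long true  true  true  = refl

bit-short : ∀ r ℓ s w → (r ≡ true → ℓ ≡ not s) → bit (r ∧ s) ≡ bit (not w ∧ r) - when r (bit ℓ - bit w)
bit-short false _ _     false _ = refl
bit-short false _ _     true  _ = refl
bit-short true  _ false false ℓ≡¬s rewrite ℓ≡¬s refl = refl
bit-short true  _ false true  ℓ≡¬s rewrite ℓ≡¬s refl = refl
bit-short true  _ true  false ℓ≡¬s rewrite ℓ≡¬s refl = refl
bit-short true  _ true  true  ℓ≡¬s rewrite ℓ≡¬s refl = refl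

bit-trichotomy : ∀ {x y z} a b → x ≡ a ∧ not b → y ≡ not a → z ≡ b → (b ≡ true → a ≡ true) →
  bit x + bit y + bit z ≡ 1ℤ
bit-trichotomy false false refl refl refl _   = refl
bit-trichotomy false true  refl refl refl b⇒a = contradiction (b⇒a refl) λ ()
bit-trichotomy true  false refl refl refl _   = refl
bit-trichotomy true  true  refl refl refl _   = refl

not-∧-absorb : ∀ x y z → (x ≡ true → z ≡ true) → (y ≡ true → z ≡ true) →
  not x ∧ (not y ∧ (not z ∧ true)) ≡ not z
not-∧-absorb x     y     true  _   _   = trans (cong (not x ∧_) (∧-zeroʳ (not y))) (∧-zeroʳ (not x))
not-∧-absorb false false false _   _   = refl
not-∧-absorb true  _     false x⇒z _   = contradiction (x⇒z refl) λ ()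
not-∧-absorb false true  false _   y⇒z = contradiction (y⇒z refl) λ ()

isRc : RType → Bool
isRc ra = false
isRc rb = false
isRc rc = true

weight : EdgeKind → RType → Bool
weight long  t = isRc t
weight short t = not (isRc t)

signed : EdgeKind → ℤ → ℤ
signed long  z = z
signed short z = - z

signed-zero : ∀ k {z} → z ≡ 0ℤ → signed k z ≡ 0ℤ
signed-zero long  z≡0 = z≡0
signed-zero short z≡0 = cong -_ z≡0

module Grove {L : Subset} {N : ℤ} {E : P → P → Bool}
             (ideal : IsOrderIdeal L) (grove : IsGrove L N E) where
  open IsGrove grove

  isRhombus : RType → P → Bool
  isRhombus t p = all (inI L) (rhombusVerts t p)

  isRhombus⇒IsRhombus : ∀ t p → isRhombus t p ≡ true → IsRhombus L t p
  isRhombus⇒IsRhombus t p r = All.map (Equivalence.to T-≡) (all⁺ (inI L) _ (Equivalence.from T-≡ r))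

  IsRhombus⇒isRhombus : ∀ t p → IsRhombus L t p → isRhombus t p ≡ true
  IsRhombus⇒isRhombus t p r = Equivalence.to T-≡ (all⁻ (inI L) (All.map (Equivalence.from T-≡) r))

  uses : EdgeKind → RType → P → Bool
  uses k t p = E (fst (edge k t p)) (snd (edge k t p))

  -- For r_c the flow is minus the indicator of the short edge rather than that of the long
  -- edge; with this normalisation the edges at a vertex of 𝓘 count 2 plus a divergence.
  flow : RType → P → ℤ
  flow t p = when (isRhombus t p) (bit (uses long t p) - bit (isRc t))

  flow-without-rhombus : ∀ {t p} → isRhombus t p ≡ false → flow t p ≡ 0ℤ
  flow-without-rhombus {t} {p} r = cong (λ b → when b (bit (uses long t p) - bit (isRc t))) r

  E-orient : ∀ o e → E (proj₁ (orient o e)) (proj₂ (orient o e)) ≡ E (fst e) (snd e)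
  E-orient forward  e       = refl
  E-orient backward (x , y) = symm y x

  edge-in-rhombus : ∀ t k o v → E v (v +P offset (t , k , o)) ≡ true →
    isRhombus t (owner (t , k , o) v) ≡ true
  edge-in-rhombus t k o v e with sub v _ e
  ... | t′ , p′ , r′ , same with edge-owner same
  ...   | k′ , o′ , refl , w≡ with offset-injective (t , k , o) (t′ , k′ , o′) (+P-cancelˡ v _ _ w≡)
  ...     | refl = IsRhombus⇒isRhombus t _ r′

  adjacent : ∀ t k o v →
    E v (v +P offset (t , k , o)) ≡ isRhombus t (owner (t , k , o) v) ∧ uses k t (owner (t , k , o) v)
  adjacent t k o v with isRhombus t (owner (t , k , o) v) in r
  ... | true  = trans (cong (λ e → E (proj₁ e) (proj₂ e)) (sym (owner-edge t k o v))) (E-orient o _)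
  ... | false = ¬-not λ e → contradiction (trans (sym (edge-in-rhombus t k o v e)) r) λ ()

  weightAt fluxAt : P → Step → ℤ
  weightAt v (t , k , o) = bit (weight k t ∧ isRhombus t (owner (t , k , o) v))
  fluxAt   v (t , k , o) = signed k (flow t (owner (t , k , o) v))

  count-step : ∀ v s → bit (E v (v +P offset s)) ≡ weightAt v s + fluxAt v s
  count-step v (t , long , o) =
    trans (cong bit (adjacent t long o v)) (bit-long (isRhombus t p) (uses long t p) (isRc t))
    where p = owner (t , long , o) v
  count-step v (t , short , o) =
    trans (cong bit (adjacent t short o v))
          (bit-short (isRhombus t p) (uses long t p) (uses short t p) (isRc t)
                     (λ r → exactlyOne t p (isRhombus⇒IsRhombus t p r)))
    where p = owner (t , short , o) v

  weights flux : P → ℤ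
  weights v = ∑ steps (weightAt v)
  flux    v = ∑ steps (fluxAt v)

  deg-split : ∀ v → + deg E v ≡ weights v + flux v
  deg-split v = begin
    + deg E v                                  ≡⟨ count-bits (λ o → E v (v +P o)) neighbourOffsets ⟩
    ∑ neighbourOffsets adjacentTo              ≡⟨ cong (λ os → ∑ os adjacentTo) (sym map-offset-steps) ⟩
    ∑ (map offset steps) adjacentTo            ≡⟨ ∑-map offset steps adjacentTo ⟩
    ∑ steps (adjacentTo ∘ offset)              ≡⟨ ∑-cong steps (count-step v) ⟩
    ∑ steps (λ s → weightAt v s + fluxAt v s)  ≡⟨ ∑-+ steps (weightAt v) (fluxAt v) ⟩
    weights v + flux v                         ∎
    where
    adjacentTo : P → ℤ
    adjacentTo o = bit (E v (v +P o))

  L-below : ∀ {p q} → L p ≡ true → q ≤P p → L q ≡ true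
  L-below {p} {q} = ideal p q

  L-above : ∀ {p q} → L p ≡ false → p ≤P q → L q ≡ false
  L-above {p} {q} p∉L p≤q = ¬-not λ q∈L → contradiction (trans (sym (ideal q p q∈L p≤q)) p∉L) λ ()

  inI-in-L : ∀ {q} → L q ≡ true → inI L q ≡ not (L (q +P 𝟏))
  inI-in-L {q} q∈L = cong (_∧ not (L (q +P 𝟏))) q∈L

  inI⇒above∉L : ∀ {q} → inI L q ≡ true → L (q +P 𝟏) ≡ false
  inI⇒above∉L {q} q∈I = trans (sym (not-involutive _)) (cong not (∧-conicalʳ (L q) _ q∈I))

  inI≡L : ∀ {q} → L (q +P 𝟏) ≡ false → inI L q ≡ L q
  inI≡L {q} h = trans (cong (λ b → L q ∧ not b) h) (∧-identityʳ (L q))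

  -- Below p every vertex is in 𝓛, hence in 𝓘 iff its translate by 𝟏 is not in 𝓛; that
  -- translate is smallest for the lowest vertex q₃.
  vertices-in-I : ∀ p q₁ q₂ q₃ → q₁ ≤P p → q₂ ≤P p → q₃ ≤P q₁ → q₃ ≤P q₂ →
    all (inI L) (p ∷ q₁ ∷ q₂ ∷ q₃ ∷ []) ≡ inI L p ∧ not (L (q₃ +P 𝟏))
  vertices-in-I p q₁ q₂ q₃ q₁≤p q₂≤p q₃≤q₁ q₃≤q₂ with inI L p in p∈I
  ... | false = refl
  ... | true  = begin
    inI L q₁ ∧ (inI L q₂ ∧ (inI L q₃ ∧ true))
      ≡⟨ cong₂ _∧_ (inI-in-L (L-below p∈L q₁≤p)) (cong₂ _∧_ (inI-in-L (L-below p∈L q₂≤p))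
                   (cong (_∧ true) (inI-in-L (L-below p∈L (≤P-trans q₃≤q₁ q₁≤p))))) ⟩
    not (L (q₁ +P 𝟏)) ∧ (not (L (q₂ +P 𝟏)) ∧ (not (L (q₃ +P 𝟏)) ∧ true))
      ≡⟨ not-∧-absorb _ _ _ (λ h → L-below h (+𝟏-mono q₃≤q₁)) (λ h → L-below h (+𝟏-mono q₃≤q₂)) ⟩
    not (L (q₃ +P 𝟏))  ∎
    where p∈L = ∧-conicalˡ (L p) _ p∈I

  isRhombus-a : ∀ i j k → isRhombus ra (i , j , k) ≡ inI L (i , j , k) ∧ not (L (i + 1ℤ , j , k))
  isRhombus-a i j k = trans
    (vertices-in-I _ _ _ _ (ℤ.≤-refl , z-1≤z j , ℤ.≤-refl) (ℤ.≤-refl , ℤ.≤-refl , z-1≤z k)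
                          (ℤ.≤-refl , ℤ.≤-refl , z-1≤z k) (ℤ.≤-refl , z-1≤z j , ℤ.≤-refl))
    (cong (λ q → inI L (i , j , k) ∧ not (L q)) (point-≡ refl (z-1+1≡z j) (z-1+1≡z k)))

  isRhombus-b : ∀ i j k → isRhombus rb (i , j , k) ≡ inI L (i , j , k) ∧ not (L (i , j + 1ℤ , k))
  isRhombus-b i j k = trans
    (vertices-in-I _ _ _ _ (z-1≤z i , ℤ.≤-refl , ℤ.≤-refl) (ℤ.≤-refl , ℤ.≤-refl , z-1≤z k)
                          (ℤ.≤-refl , ℤ.≤-refl , z-1≤z k) (z-1≤z i , ℤ.≤-refl , ℤ.≤-refl))
    (cong (λ q → inI L (i , j , k) ∧ not (L q)) (point-≡ (z-1+1≡z i) refl (z-1+1≡z k)))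

  isRhombus-c : ∀ i j k → isRhombus rc (i , j , k) ≡ inI L (i , j , k) ∧ not (L (i , j , k + 1ℤ))
  isRhombus-c i j k = trans
    (vertices-in-I _ _ _ _ (z-1≤z i , ℤ.≤-refl , ℤ.≤-refl) (ℤ.≤-refl , z-1≤z j , ℤ.≤-refl)
                          (ℤ.≤-refl , z-1≤z j , ℤ.≤-refl) (z-1≤z i , ℤ.≤-refl , ℤ.≤-refl))
    (cong (λ q → inI L (i , j , k) ∧ not (L q)) (point-≡ (z-1+1≡z i) (z-1+1≡z j) refl))

  weights-on-I : ∀ i j k → inI L (i , j , k) ≡ true → weights (i , j , k) ≡ + 2
  weights-on-I i j k v∈I = begin
    weights (i , j , k)
      ≡⟨ regroup (bit c₁) (bit c₂) (bit a₂) (bit a₁) (bit b₂) (bit b₁) ⟩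
    (bit c₁ + bit a₁ + bit b₂) + (bit c₂ + bit b₁ + bit a₂)
      ≡⟨ cong₂ _+_ trio₁ trio₂ ⟩
    + 2  ∎
    where
    regroup : ∀ c₁ c₂ a₂ a₁ b₂ b₁ →
      0ℤ + (0ℤ + (0ℤ + (0ℤ + (c₁ + (c₂ + (a₂ + (a₁ + (b₂ + (b₁ + (0ℤ + (0ℤ + 0ℤ)))))))))))
        ≡ (c₁ + a₁ + b₂) + (c₂ + b₁ + a₂)
    regroup = solve-∀
    c₁ = isRhombus rc (i + 1ℤ , j , k)
    c₂ = isRhombus rc (i , j + 1ℤ , k)
    a₁ = isRhombus ra (i , j , k)
    a₂ = isRhombus ra (i , j + 1ℤ , k + 1ℤ)
    b₁ = isRhombus rb (i , j , k)
    b₂ = isRhombus rb (i + 1ℤ , j , k + 1ℤ)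
    v+𝟏∉L : L (i + 1ℤ , j + 1ℤ , k + 1ℤ) ≡ false
    v+𝟏∉L = inI⇒above∉L v∈I
    above : ∀ {q} → (i + 1ℤ , j + 1ℤ , k + 1ℤ) ≤P (q +P 𝟏) → inI L q ≡ L q
    above le = inI≡L (L-above v+𝟏∉L le)
    trio₁ : bit c₁ + bit a₁ + bit b₂ ≡ 1ℤ
    trio₁ = bit-trichotomy (L (i + 1ℤ , j , k)) (L (i + 1ℤ , j , k + 1ℤ))
      (trans (isRhombus-c (i + 1ℤ) j k)
             (cong (_∧ not (L (i + 1ℤ , j , k + 1ℤ))) (above (z≤z+1 _ , ℤ.≤-refl , ℤ.≤-refl))))
      (trans (isRhombus-a i j k) (cong (_∧ not (L (i + 1ℤ , j , k))) v∈I))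
      (trans (isRhombus-b (i + 1ℤ) j (k + 1ℤ))
        (trans (cong₂ (λ x y → x ∧ not y) (above (z≤z+1 _ , ℤ.≤-refl , z≤z+1 _)) v+𝟏∉L) (∧-identityʳ _)))
      (λ h → L-below h (ℤ.≤-refl , ℤ.≤-refl , z≤z+1 k))
    trio₂ : bit c₂ + bit b₁ + bit a₂ ≡ 1ℤ
    trio₂ = bit-trichotomy (L (i , j + 1ℤ , k)) (L (i , j + 1ℤ , k + 1ℤ))
      (trans (isRhombus-c i (j + 1ℤ) k)
             (cong (_∧ not (L (i , j + 1ℤ , k + 1ℤ))) (above (ℤ.≤-refl , z≤z+1 _ , ℤ.≤-refl))))
      (trans (isRhombus-b i j k) (cong (_∧ not (L (i , j + 1ℤ , k))) v∈I))
      (trans (isRhombus-a i (j + 1ℤ) (k + 1ℤ))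
        (trans (cong₂ (λ x y → x ∧ not y) (above (ℤ.≤-refl , z≤z+1 _ , z≤z+1 _)) v+𝟏∉L) (∧-identityʳ _)))
      (λ h → L-below h (ℤ.≤-refl , ℤ.≤-refl , z≤z+1 k))

  deg-on-I : ∀ i j k → inI L (i , j , k) ≡ true → + deg E (i , j , k) ≡ + 2 + flux (i , j , k)
  deg-on-I i j k v∈I =
    trans (deg-split (i , j , k)) (cong (_+ flux (i , j , k)) (weights-on-I i j k v∈I))

  owner-vertex : ∀ t k o v → isRhombus t (owner (t , k , o) v) ≡ true → inI L v ≡ true
  owner-vertex t k o v r = subst (λ x → inI L x ≡ true) (cong proj₁ (owner-edge t k o v))
    (All.lookup (isRhombus⇒IsRhombus t _ r) (source-vertex t k o _))

  flux-outside-I : ∀ v → inI L v ≡ false → flux v ≡ 0ℤ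
  flux-outside-I v v∉I = ∑-zero steps no-flux
    where
    no-flux : ∀ s → fluxAt v s ≡ 0ℤ
    no-flux (t , k , o) = signed-zero k (flow-without-rhombus {t}
      (¬-not λ r → contradiction (trans (sym (owner-vertex t k o v r)) v∉I) λ ()))

  potentialK potentialI : ℤ → ℤ → ℤ → ℤ
  potentialK i j k = flow ra (i , j , k) - flow ra (i , j + 1ℤ , k)
  potentialI i j k = (flow rb (i , j , k) - flow rb (i , j , k + 1ℤ))
                   + (flow rc (i , j , k) - flow rc (i , j + 1ℤ , k))

  flux-divergence : ∀ i j k → flux (i , j , k) ≡
    (potentialK i j (k + 1ℤ) - potentialK i j k) + (potentialI (i + 1ℤ) j k - potentialI i j k)
  flux-divergence i j k = regroup
    (flow ra (i , j + 1ℤ , k)) (flow ra (i , j , k + 1ℤ)) (flow rb (i + 1ℤ , j , k))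
    (flow rb (i , j , k + 1ℤ)) (flow rc (i + 1ℤ , j , k)) (flow rc (i , j + 1ℤ , k))
    (flow ra (i , j + 1ℤ , k + 1ℤ)) (flow ra (i , j , k)) (flow rb (i + 1ℤ , j , k + 1ℤ))
    (flow rb (i , j , k)) (flow rc (i + 1ℤ , j + 1ℤ , k)) (flow rc (i , j , k))
    where
    regroup : ∀ a₁ a₂ b₁ b₂ c₁ c₂ a₃ a₄ b₃ b₄ c₃ c₄ →
      a₁ + (a₂ + (b₁ + (b₂ + (c₁ + (c₂ + (- a₃ + (- a₄ + (- b₃ + (- b₄ + (- c₃ + (- c₄ + 0ℤ)))))))))))
        ≡ ((a₂ - a₃) - (a₄ - a₁)) + (((b₁ - b₃) + (c₁ - c₃)) - ((b₄ - b₂) + (c₄ - c₂)))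
    regroup = solve-∀

  rhombus-apex : ∀ t p → isRhombus t p ≡ true → inI L p ≡ true
  rhombus-apex ra (i , j , k) r = All.head (isRhombus⇒IsRhombus ra _ r)
  rhombus-apex rb (i , j , k) r = All.head (isRhombus⇒IsRhombus rb _ r)
  rhombus-apex rc (i , j , k) r = All.head (isRhombus⇒IsRhombus rc _ r)

  flow-of-rhombus : ∀ {t p} → isRhombus t p ≡ true → flow t p ≡ bit (uses long t p) - bit (isRc t)
  flow-of-rhombus {t} {p} r = cong (λ b → when b (bit (uses long t p) - bit (isRc t))) r

  a-rhombi-not-stacked : ∀ {a b j k} → isRhombus ra (a , j , k) ≡ true → isRhombus ra (b , j , k) ≡ true →
    ¬ a < b
  a-rhombi-not-stacked {a} {b} {j} {k} ra∈ rb∈ a<b =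
    contradiction (trans (sym (cong not above∈L)) above∉L) λ ()
    where
    above∉L : not (L (a + 1ℤ , j , k)) ≡ true
    above∉L = ∧-conicalʳ _ _ (trans (sym (isRhombus-a a j k)) ra∈)
    above∈L : L (a + 1ℤ , j , k) ≡ true
    above∈L = L-below (∧-conicalˡ _ _ (rhombus-apex ra _ rb∈)) (<⇒+1≤ a<b , ℤ.≤-refl , ℤ.≤-refl)

  a-rhombus-unique : ∀ {a b j k} → isRhombus ra (a , j , k) ≡ true → isRhombus ra (b , j , k) ≡ true →
    a ≡ b
  a-rhombus-unique {a} {b} ra∈ rb∈ with ℤ.<-cmp a b
  ... | tri< a<b _ _ = contradiction a<b (a-rhombi-not-stacked ra∈ rb∈)
  ... | tri≈ _ a≡b _ = a≡b
  ... | tri> _ _ b<a = contradiction b<a (a-rhombi-not-stacked rb∈ ra∈)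

module FarField {L : Subset} {N : ℤ} {E : P → P → Bool} (ideal : IsOrderIdeal L) (grove : IsGrove L N E)
                (L⊆C : ∀ p → L p ≡ true → p ≤P origin) (cutoff : IsCutoff L N)
                (M : ℕ) (N<M : N < + M) where
  open IsGrove grove
  open Grove ideal grove

  flow-beyond-origin : ∀ t j k → flow t (1ℤ , j , k) ≡ 0ℤ
  flow-beyond-origin t j k = flow-without-rhombus {t} (¬-not λ r →
    contradiction (proj₁ (L⊆C _ (∧-conicalˡ _ _ (rhombus-apex t _ r)))) λ { (+≤+ ()) })

  Far : P → Set
  Far (a , b , c) = a ≤ - + M ⊎ b ≤ - + M ⊎ c ≤ - + M

  Far-≤ : ∀ {p q} → q ≤P p → Far p → Far q
  Far-≤ (a≤ , _ , _) (inj₁ far)        = inj₁ (ℤ.≤-trans a≤ far)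
  Far-≤ (_ , b≤ , _) (inj₂ (inj₁ far)) = inj₂ (inj₁ (ℤ.≤-trans b≤ far))
  Far-≤ (_ , _ , c≤) (inj₂ (inj₂ far)) = inj₂ (inj₂ (ℤ.≤-trans c≤ far))

  far-sum : ∀ {u} a b c → a ≤ u → b ≤ u → c ≤ u → Far (a , b , c) → a + b + c ≤ - + M + u + u
  far-sum a b c _ b≤u c≤u (inj₁ far) = ℤ.+-mono-≤ (ℤ.+-mono-≤ far b≤u) c≤u
  far-sum {u} a b c a≤u _ c≤u (inj₂ (inj₁ far)) =
    ℤ.≤-trans (ℤ.+-mono-≤ (ℤ.+-mono-≤ a≤u far) c≤u) (ℤ.≤-reflexive (swap₁₂ u (- + M) u))
    where swap₁₂ : ∀ x y z → x + y + z ≡ y + x + z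
          swap₁₂ = solve-∀
  far-sum {u} a b c a≤u b≤u _ (inj₂ (inj₂ far)) =
    ℤ.≤-trans (ℤ.+-mono-≤ (ℤ.+-mono-≤ a≤u b≤u) far) (ℤ.≤-reflexive (rotate u u (- + M)))
    where rotate : ∀ x y z → x + y + z ≡ z + x + y
          rotate = solve-∀

  far-in-L : ∀ {q} → L q ≡ true → Far q → sumP q < - N
  far-in-L {a , b , c} q∈L far =
    ℤ.≤-<-trans (ℤ.≤-trans (far-sum a b c a≤0 b≤0 c≤0 far) (ℤ.≤-reflexive (+0+0 (- + M))))
                (ℤ.neg-mono-< N<M)
    where
    a≤0 = proj₁ (L⊆C _ q∈L)
    b≤0 = proj₁ (proj₂ (L⊆C _ q∈L))
    c≤0 = proj₂ (proj₂ (L⊆C _ q∈L))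
    +0+0 : ∀ x → x + 0ℤ + 0ℤ ≡ x
    +0+0 = solve-∀

  far-below-cutoff : ∀ a b c → a ≤ - 1ℤ → b ≤ - 1ℤ → c ≤ - 1ℤ → Far (a , b , c) →
    inI L (a , b , c) ≡ false
  far-below-cutoff a b c a≤-1 b≤-1 c≤-1 far = proj₂ cutoff a b c
    (ℤ.≤-trans (far-sum a b c a≤-1 b≤-1 c≤-1 far) radius)
    (ℤ.≤-<-trans (ℤ.⊔-lub a≤-1 (ℤ.⊔-lub b≤-1 c≤-1)) -<+)
    where
    shift : ∀ n → - (1ℤ + n) + - 1ℤ + - 1ℤ ≡ - n - + 3
    shift = solve-∀
    radius : - + M + - 1ℤ + - 1ℤ ≤ - N - + 3
    radius = ℤ.≤-trans (ℤ.+-monoˡ-≤ (- 1ℤ) (ℤ.+-monoˡ-≤ (- 1ℤ) (ℤ.neg-mono-≤ (ℤ.i<j⇒suc[i]≤j N<M))))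
                       (ℤ.≤-reflexive (shift N))

  far-long-unused : ∀ t p → isRhombus t p ≡ true → Far p → uses long t p ≡ false
  far-long-unused t p r far = trans (exactlyOne t p R) (cong not (farShort t p R deep))
    where
    R = isRhombus⇒IsRhombus t p r
    deep : All (λ q → sumP q < - N) (rhombusVerts t p)
    deep = All.zipWith (λ (q∈I , q≤p) → far-in-L (∧-conicalˡ _ _ q∈I) (Far-≤ q≤p far))
                       (R , vertices-≤ t p)

  far-flow : ∀ t p → isRc t ≡ false → Far p → flow t p ≡ 0ℤ
  far-flow t p t≢rc far with isRhombus t p in r
  ... | false = refl
  ... | true  = cong₂ (λ x y → bit x - bit y) (far-long-unused t p r far) t≢rc

  -- Far rhombi of type c would have a lowest vertex that part (ii) of the cutoff excludes from 𝓘.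
  far-no-c-rhombus : ∀ p → Far p → proj₂ (proj₂ p) < 0ℤ → isRhombus rc p ≡ false
  far-no-c-rhombus (a , b , c) far c<0 = ¬-not λ r → lowest (isRhombus⇒IsRhombus rc _ r)
    where
    lowest : IsRhombus L rc (a , b , c) → ⊥
    lowest (p∈I ∷ _ ∷ _ ∷ q∈I ∷ []) = contradiction
      (trans (sym q∈I) (far-below-cutoff (a - 1ℤ) (b - 1ℤ) c
        (ℤ.+-monoˡ-≤ (- 1ℤ) (proj₁ p≤0)) (ℤ.+-monoˡ-≤ (- 1ℤ) (proj₁ (proj₂ p≤0))) (ℤ.i<j⇒i≤pred[j] c<0)
        (Far-≤ (z-1≤z a , z-1≤z b , ℤ.≤-refl) far))) λ ()
      where p≤0 = L⊆C _ (∧-conicalˡ _ _ p∈I)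

  deg-far : ∀ i j k → inI L (i , j , k) ≡ true → k < 0ℤ →
    (i < - + M) ⊎ (j < - + M) ⊎ (k < - + M) → deg E (i , j , k) ≡ 2
  deg-far i j k v∈I k<0 beyond =
    ℤ.+-injective (trans (deg-on-I i j k v∈I) (cong (_+_ (+ 2)) (∑-zero steps quiet)))
    where
    v = (i , j , k)
    far+𝟏 : Far (v +P 𝟏)
    far+𝟏 = ⊎.map <⇒+1≤ (⊎.map <⇒+1≤ <⇒+1≤) beyond
    far-owner : ∀ s → Far (owner s v)
    far-owner s = Far-≤ (owner-≤ s v) far+𝟏
    quiet : ∀ s → fluxAt v s ≡ 0ℤ
    quiet (ra , k , o) = signed-zero k (far-flow ra _ refl (far-owner (ra , k , o)))
    quiet (rb , k , o) = signed-zero k (far-flow rb _ refl (far-owner (rb , k , o)))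
    quiet (rc , k , o) = signed-zero k (flow-without-rhombus {rc}
      (far-no-c-rhombus _ (far-owner (rc , k , o)) (subst (_< 0ℤ) (sym (owner-c-level k o v)) k<0)))

  module Box (i₀ j₀ k₀ : ℤ) (-M≤i₀ : - + M ≤ i₀) (-M≤j₀ : - + M ≤ j₀) (-M≤k₀ : - + M ≤ k₀)
             (apex≤0 : (i₀ , j₀ , k₀) ≤P origin) (r₀ : isRhombus ra (i₀ , j₀ , k₀) ≡ true) where

    R : List ℤ
    R = range M

    inJ inK : ℤ → Bool
    inJ j = does (j <? j₀)
    inK k = does (k <? k₀)

    ∑³ : (ℤ → ℤ → ℤ → ℤ) → ℤ
    ∑³ f = ∑ R λ i → ∑ R λ j → ∑ R λ k → f i j k

    ∑³-cong : ∀ {f g} → (∀ i j k → f i j k ≡ g i j k) → ∑³ f ≡ ∑³ g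
    ∑³-cong f≗g = ∑-cong R λ i → ∑-cong R λ j → ∑-cong R λ k → f≗g i j k

    ∑³-+ : ∀ f g → ∑³ (λ i j k → f i j k + g i j k) ≡ ∑³ f + ∑³ g
    ∑³-+ f g = trans (∑-cong R λ i → trans (∑-cong R λ j → ∑-+ R (f i j) (g i j))
                                            (∑-+ R (λ j → ∑ R (f i j)) (λ j → ∑ R (g i j))))
                     (∑-+ R (λ i → ∑ R λ j → ∑ R (f i j)) (λ i → ∑ R λ j → ∑ R (g i j)))

    restrict : ℤ → ℤ → ℤ → ℤ
    restrict j k z = when (inJ j) (when (inK k) z)

    restrict-+ : ∀ j k x y → restrict j k (x + y) ≡ restrict j k x + restrict j k y
    restrict-+ j k x y = trans (cong (when (inJ j)) (when-+ (inK k) x y)) (when-+ (inJ j) _ _)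

    restrict-sub : ∀ j k x y → restrict j k (x - y) ≡ restrict j k x - restrict j k y
    restrict-sub j k x y = trans (cong (when (inJ j)) (when-sub (inK k) x y)) (when-sub (inJ j) _ _)

    restrict-0 : ∀ j k → restrict j k 0ℤ ≡ 0ℤ
    restrict-0 j k = trans (cong (when (inJ j)) (when-0 (inK k))) (when-0 (inJ j))

    summand : ℤ → ℤ → ℤ → ℤ
    summand i j k = if inI L (i , j , k) ∧ inJ j ∧ inK k then + deg E (i , j , k) - two else 0ℤ

    summand-flux : ∀ i j k → summand i j k ≡ restrict j k (flux (i , j , k))
    summand-flux i j k = by-cases (inI L v) (inJ j) (inK k) refl
      where
      v = (i , j , k)
      cancel-2 : ∀ x → + 2 + x - two ≡ x
      cancel-2 = solve-∀
      by-cases : ∀ b bj bk → inI L v ≡ b →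
        (if b ∧ bj ∧ bk then + deg E v - two else 0ℤ) ≡ when bj (when bk (flux v))
      by-cases true  true  true  v∈I = trans (cong (_- two) (deg-on-I i j k v∈I)) (cancel-2 (flux v))
      by-cases true  true  false _   = refl
      by-cases true  false _     _   = refl
      by-cases false bj    bk    v∉I = sym (begin
        when bj (when bk (flux v))  ≡⟨ cong (when bj ∘ when bk) (flux-outside-I v v∉I) ⟩
        when bj (when bk 0ℤ)        ≡⟨ cong (when bj) (when-0 bk) ⟩
        when bj 0ℤ                  ≡⟨ when-0 bj ⟩
        0ℤ                          ∎)

    kDivergence iDivergence : ℤ → ℤ → ℤ → ℤ
    kDivergence i j k = restrict j k (potentialK i j (k + 1ℤ) - potentialK i j k)
    iDivergence i j k = restrict j k (potentialI (i + 1ℤ) j k - potentialI i j k)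

    boxSum-flux : boxSum L E j₀ k₀ M ≡ ∑³ (λ i j k → restrict j k (flux (i , j , k)))
    boxSum-flux = begin
      boxSum L E j₀ k₀ M
        ≡⟨ ∑-concatMap (λ i → concatMap (λ j → map (summand i j) R) R) R ⟩
      ∑ R (λ i → sumℤ (concatMap (λ j → map (summand i j) R) R))
        ≡⟨ ∑-cong R (λ i → ∑-concatMap (λ j → map (summand i j) R) R) ⟩
      ∑³ summand
        ≡⟨ ∑³-cong summand-flux ⟩
      ∑³ (λ i j k → restrict j k (flux (i , j , k)))  ∎

    k<k₀⇒k<0 : ∀ {k} → k < k₀ → k < 0ℤ
    k<k₀⇒k<0 k<k₀ = ℤ.<-≤-trans k<k₀ (proj₂ (proj₂ apex≤0))

    potentialI-at-1 : ∀ j k → potentialI 1ℤ j k ≡ 0ℤ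
    potentialI-at-1 j k = cong₂ _+_
      (cong₂ _-_ (flow-beyond-origin rb j k) (flow-beyond-origin rb j (k + 1ℤ)))
      (cong₂ _-_ (flow-beyond-origin rc j k) (flow-beyond-origin rc (j + 1ℤ) k))

    potentialI-at-edge : ∀ j k → k < 0ℤ → potentialI (- + M) j k ≡ 0ℤ
    potentialI-at-edge j k k<0 = cong₂ _+_
      (cong₂ _-_ (far-flow rb _ refl (inj₁ ℤ.≤-refl)) (far-flow rb _ refl (inj₁ ℤ.≤-refl)))
      (cong₂ _-_ (flow-without-rhombus {rc} (far-no-c-rhombus _ (inj₁ ℤ.≤-refl) k<0))
                 (flow-without-rhombus {rc} (far-no-c-rhombus _ (inj₁ ℤ.≤-refl) k<0)))

    layer : ℤ → ℤ
    layer i = ∑ R λ j → ∑ R λ k → restrict j k (potentialI i j k)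

    layer-at-1 : layer 1ℤ ≡ 0ℤ
    layer-at-1 = ∑-zero R λ j → ∑-zero R λ k →
      trans (cong (restrict j k) (potentialI-at-1 j k)) (restrict-0 j k)

    layer-at-edge : layer (- + M) ≡ 0ℤ
    layer-at-edge = ∑-zero R λ j → ∑-zero R λ k → vanish j k
      where
      vanish : ∀ j k → restrict j k (potentialI (- + M) j k) ≡ 0ℤ
      vanish j k with k <? k₀
      ... | yes k<k₀ = trans (cong (when (inJ j)) (potentialI-at-edge j k (k<k₀⇒k<0 k<k₀))) (when-0 _)
      ... | no  _    = when-0 _

    layer-difference : ∀ i → ∑ R (λ j → ∑ R λ k → restrict j k (potentialI (i + 1ℤ) j k - potentialI i j k))
                         ≡ layer (i + 1ℤ) - layer i
    layer-difference i = begin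
      ∑ R (λ j → ∑ R λ k → restrict j k (potentialI (i + 1ℤ) j k - potentialI i j k))
        ≡⟨ ∑-cong R (λ j → trans (∑-cong R λ k → restrict-sub j k _ _) (∑-sub R (upper j) (lower j))) ⟩
      ∑ R (λ j → ∑ R (upper j) - ∑ R (lower j))
        ≡⟨ ∑-sub R (λ j → ∑ R (upper j)) (λ j → ∑ R (lower j)) ⟩
      layer (i + 1ℤ) - layer i ∎
      where
      upper lower : ℤ → ℤ → ℤ
      upper j k = restrict j k (potentialI (i + 1ℤ) j k)
      lower j k = restrict j k (potentialI i j k)

    ∑³-iDivergence : ∑³ iDivergence ≡ 0ℤ
    ∑³-iDivergence = begin
      ∑³ iDivergence
        ≡⟨ ∑-cong R layer-difference ⟩
      ∑ R (λ i → layer (i + 1ℤ) - layer i)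
        ≡⟨ telescope M layer ⟩
      layer 1ℤ - layer (- + M)
        ≡⟨ cong₂ _-_ layer-at-1 layer-at-edge ⟩
      0ℤ ∎

    ≤0⇒≤1 : ∀ {z} → z ≤ 0ℤ → z ≤ 1ℤ
    ≤0⇒≤1 z≤0 = ℤ.≤-trans z≤0 (+≤+ ℕ.z≤n)

    potentialK-at-edge : ∀ i j → potentialK i j (- + M) ≡ 0ℤ
    potentialK-at-edge i j =
      cong₂ _-_ (far-flow ra _ refl (inj₂ (inj₂ ℤ.≤-refl))) (far-flow ra _ refl (inj₂ (inj₂ ℤ.≤-refl)))

    sum-over-k : ∀ i j → ∑ R (λ k → restrict j k (potentialK i j (k + 1ℤ) - potentialK i j k))
                         ≡ when (inJ j) (potentialK i j k₀)
    sum-over-k i j = begin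
      ∑ R (λ k → when (inJ j) (when (inK k) (Δk k)))
        ≡⟨ ∑-when R (inJ j) (λ k → when (inK k) (Δk k)) ⟩
      when (inJ j) (∑ R (λ k → when (inK k) (Δk k)))
        ≡⟨ cong (when (inJ j)) (telescope-below M -M≤k₀ (≤0⇒≤1 (proj₂ (proj₂ apex≤0))) (potentialK i j)) ⟩
      when (inJ j) (potentialK i j k₀ - potentialK i j (- + M))
        ≡⟨ cong (λ z → when (inJ j) (potentialK i j k₀ - z)) (potentialK-at-edge i j) ⟩
      when (inJ j) (potentialK i j k₀ + 0ℤ)
        ≡⟨ cong (when (inJ j)) (ℤ.+-identityʳ _) ⟩
      when (inJ j) (potentialK i j k₀)  ∎
      where
      Δk : ℤ → ℤ
      Δk k = potentialK i j (k + 1ℤ) - potentialK i j k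

    sum-over-j : ∀ i → ∑ R (λ j → when (inJ j) (potentialK i j k₀)) ≡ - flow ra (i , j₀ , k₀)
    sum-over-j i = begin
      ∑ R (λ j → when (inJ j) (potentialK i j k₀))
        ≡⟨ ∑-cong R (λ j → trans (cong (when (inJ j)) (flip-difference (h j) (h (j + 1ℤ))))
                                 (when-neg (inJ j) (h (j + 1ℤ) - h j))) ⟩
      ∑ R (λ j → - when (inJ j) (h (j + 1ℤ) - h j))
        ≡⟨ ∑-neg R (λ j → when (inJ j) (h (j + 1ℤ) - h j)) ⟩
      - ∑ R (λ j → when (inJ j) (h (j + 1ℤ) - h j))
        ≡⟨ cong -_ (telescope-below M -M≤j₀ (≤0⇒≤1 (proj₁ (proj₂ apex≤0))) h) ⟩
      - (h j₀ - h (- + M))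
        ≡⟨ cong (λ z → - (h j₀ - z)) (far-flow ra _ refl (inj₂ (inj₁ ℤ.≤-refl))) ⟩
      - (h j₀ + 0ℤ)
        ≡⟨ cong -_ (ℤ.+-identityʳ _) ⟩
      - h j₀ ∎
      where
      h : ℤ → ℤ
      h j = flow ra (i , j , k₀)
      flip-difference : ∀ x y → x - y ≡ - (y - x)
      flip-difference = solve-∀

    ∑³-kDivergence : ∑³ kDivergence ≡ - flow ra (i₀ , j₀ , k₀)
    ∑³-kDivergence = begin
      ∑³ kDivergence
        ≡⟨ ∑-cong R (λ i → trans (∑-cong R (sum-over-k i)) (sum-over-j i)) ⟩
      ∑ R (λ i → - flow ra (i , j₀ , k₀))
        ≡⟨ ∑-neg R (λ i → flow ra (i , j₀ , k₀)) ⟩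
      - ∑ R (λ i → flow ra (i , j₀ , k₀))
        ≡⟨ cong -_ (∑-range-single -M≤i₀ (proj₁ apex≤0) _ λ i i≢i₀ →
              flow-without-rhombus {ra} (¬-not λ r → i≢i₀ (a-rhombus-unique r r₀))) ⟩
      - flow ra (i₀ , j₀ , k₀) ∎

    boxSum-value : boxSum L E j₀ k₀ M ≡ - bit (uses long ra (i₀ , j₀ , k₀))
    boxSum-value = begin
      boxSum L E j₀ k₀ M
        ≡⟨ boxSum-flux ⟩
      ∑³ (λ i j k → restrict j k (flux (i , j , k)))
        ≡⟨ ∑³-cong (λ i j k → trans (cong (restrict j k) (flux-divergence i j k)) (restrict-+ j k _ _)) ⟩
      ∑³ (λ i j k → kDivergence i j k + iDivergence i j k)
        ≡⟨ ∑³-+ kDivergence iDivergence ⟩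
      ∑³ kDivergence + ∑³ iDivergence
        ≡⟨ cong₂ _+_ ∑³-kDivergence ∑³-iDivergence ⟩
      - flow ra (i₀ , j₀ , k₀) + 0ℤ
        ≡⟨ ℤ.+-identityʳ _ ⟩
      - flow ra (i₀ , j₀ , k₀)
        ≡⟨ cong -_ (trans (flow-of-rhombus {ra} r₀) (ℤ.+-identityʳ _)) ⟩
      - bit (uses long ra (i₀ , j₀ , k₀)) ∎

-∣∣≤ : ∀ z → - + ∣ z ∣ ≤ z
-∣∣≤ (+ n)      = ℤ.neg-≤-pos
-∣∣≤ -[1+ n ]  = ℤ.≤-refl

<suc∣∣ : ∀ z → z < + ℕ.suc ∣ z ∣
<suc∣∣ (+ n)     = +<+ (ℕ.n<1+n n)
<suc∣∣ -[1+ n ] = -<+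

radius : ∀ N a b c → ∃ λ M → N < + M × - + M ≤ a × - + M ≤ b × - + M ≤ c
radius N a b c = M
  , ℤ.<-≤-trans (<suc∣∣ N) (+≤+ (ℕ.m≤n⇒m≤n+o ∣ c ∣ (ℕ.m≤n⇒m≤n+o ∣ b ∣ (ℕ.m≤m+n _ ∣ a ∣))))
  , within a (ℕ.m≤n⇒m≤n+o ∣ c ∣ (ℕ.m≤n⇒m≤n+o ∣ b ∣ (ℕ.m≤n+m ∣ a ∣ _)))
  , within b (ℕ.m≤n⇒m≤n+o ∣ c ∣ (ℕ.m≤n+m ∣ b ∣ _))
  , within c (ℕ.m≤n+m ∣ c ∣ _)
  where
  M : ℕ
  M = ℕ.suc ∣ N ∣ ℕ.+ ∣ a ∣ ℕ.+ ∣ b ∣ ℕ.+ ∣ c ∣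
  within : ∀ z {n} → ∣ z ∣ ℕ.≤ n → - + n ≤ z
  within z ∣z∣≤n = ℤ.≤-trans (ℤ.neg-mono-≤ (+≤+ ∣z∣≤n)) (-∣∣≤ z)

theorem3 : (L : Subset) → IsOrderIdeal L →
    (∀ p → L p ≡ true → p ≤P origin) →
    (∃ λ (xs : List P) → ∀ p → p ≤P origin → L p ≡ false → p ∈ xs) →
    (i0 j0 k0 : ℤ) → IsRhombus L ra (i0 , j0 , k0) →
    (N : ℤ) → IsCutoff L N →
    (E : P → P → Bool) → IsGrove L N E →
    ∃ λ (M : ℕ) →
      (∀ i j k → inI L (i , j , k) ≡ true → j < j0 → k < k0 →
         (i < - (+ M)) ⊎ (j < - (+ M)) ⊎ (k < - (+ M)) →
         deg E (i , j , k) ≡ 2) ×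
      (E (fst (longEdge ra (i0 , j0 , k0))) (snd (longEdge ra (i0 , j0 , k0))) ≡ true →
         boxSum L E j0 k0 M ≡ - 1ℤ) ×
      (E (fst (longEdge ra (i0 , j0 , k0))) (snd (longEdge ra (i0 , j0 , k0))) ≡ false →
         boxSum L E j0 k0 M ≡ 0ℤ)
theorem3 L ideal L⊆C _ i0 j0 k0 r₀ N cutoff E grove with radius N i0 j0 k0
... | M , N<M , -M≤i0 , -M≤j0 , -M≤k0 =
  M , (λ i j k v∈I _ k<k0 → deg-far i j k v∈I (ℤ.<-≤-trans k<k0 (proj₂ (proj₂ apex≤0))))
    , (λ long∈G → trans boxSum-value (cong (-_ ∘ bit) long∈G))
    , (λ long∉G → trans boxSum-value (cong (-_ ∘ bit) long∉G))
  where
  open Grove ideal grove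
  apex≤0 : (i0 , j0 , k0) ≤P origin
  apex≤0 = L⊆C _ (∧-conicalˡ _ _ (All.head r₀))
  open FarField ideal grove L⊆C cutoff M N<M
  open Box i0 j0 k0 -M≤i0 -M≤j0 -M≤k0 apex≤0 (IsRhombus⇒isRhombus ra _ r₀)
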